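{- Let $q$ be a prime, let $k,n\ge 1$, and let $C_1$, $C_2$ be linear $[n,k]_q$ codes with generator matrices $G_1$, $G_2$ (each $k\times n$). For $i=1,2$ let $A_{G_i}=G_{q,k}^{\mathrm T}G_i$ and let $\mathcal{N}(A_{G_i})$ be the binary matrix obtained from $A_{G_i}$ by replacing every nonzero entry by $1$. If the binary matrices $\mathcal{N}(A_{G_1})$ and $\mathcal{N}(A_{G_2})$ are not isomorphic, then $C_1$ and $C_2$ are not equivalent.
   Context: $G_{q,k}$ denotes the $k\times\frac{q^k-1}{q-1}$ matrix over $\mathbb{F}_q$ whose columns are the normalized coordinate vectors (first nonzero coordinate equal to $1$) of all points of the projective space $\mathrm{PG}(k-1,q)$, ordered lexicographically; thus the rows of $A_{G}=G_{q,k}^{\mathrm T}G$ are the codewords $u^{\mathrm T}G$ for the normalized nonzero vectors $u\in\mathbb{F}_q^k$. Two binary matrices of the same size are isomorphic if one can be obtained from the other by permuting its rows and permuting its columns. Two linear $[n,k]_q$ codes are equivalent if the codewords of one are obtained from those of the other by a finite sequence of: permutations of coordinate positions, multiplication of a coordinate position by a nonzero element of $\mathbb{F}_q$, and application of a field automorphism to all coordinates. -}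

module Defs where

open import Data.Nat using (ℕ; NonZero; _<_; _≡ᵇ_) renaming (_+_ to _+ℕ_; _*_ to _*ℕ_)
open import Data.Nat.DivMod using (_mod_)

open import Data.Fin using (Fin; toℕ)
open import Data.Vec using (Vec; []; _∷_; zipWith; map; replicate; lookup; tabulate; updateAt)
open import Data.Bool using (Bool; true; false; if_then_else_; not; T)
open import Data.Product using (Σ; ∃; _×_; _,_)
open import Data.Sum using (_⊎_)
open import Function.Bundles using (_↔_; _⇔_; Inverse)
open import Relation.Binary.PropositionalEquality using (_≡_; _≢_)
open import Relation.Binary.Construct.Closure.ReflexiveTransitive using (Star)

module _ (q : ℕ) .{{_ : NonZero q}} where

  F : Set
  F = Fin q

  infixl 6 _⊕_
  infixl 7 _⊗_

  _⊕_ : F → F → F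
  a ⊕ b = (toℕ a +ℕ toℕ b) mod q

  _⊗_ : F → F → F
  a ⊗ b = (toℕ a *ℕ toℕ b) mod q

  𝟘 : F
  𝟘 = 0 mod q

  𝟙 : F
  𝟙 = 1 mod q

  isZero : F → Bool
  isZero a = toℕ a ≡ᵇ 0

  isOne : F → Bool
  isOne a = toℕ a ≡ᵇ 1

  Word : ℕ → Set
  Word n = Vec F n

  zeroW : ∀ {n} → Word n
  zeroW = replicate _ 𝟘

  _+W_ : ∀ {n} → Word n → Word n → Word n
  _+W_ = zipWith _⊕_

  scaleW : ∀ {n} → F → Word n → Word n
  scaleW c = map (c ⊗_)

  Matrix : ℕ → ℕ → Set
  Matrix k n = Vec (Word n) k

  vecMat : ∀ {k n} → Word k → Matrix k n → Word n
  vecMat []      []      = zeroW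
  vecMat (c ∷ u) (r ∷ G) = scaleW c r +W vecMat u G

  FullRank : ∀ {k n} → Matrix k n → Set
  FullRank {k} G = ∀ (u : Word k) → vecMat u G ≡ zeroW → u ≡ zeroW

  Code : ∀ {k n} → Matrix k n → Word n → Set
  Code G w = ∃ λ u → vecMat u G ≡ w

  -- Points of PG(k-1,q): normalized nonzero vectors
  -- (first nonzero coordinate equal to 1).

  isNormalized : ∀ {k} → Word k → Bool
  isNormalized []      = false
  isNormalized (x ∷ u) = if isZero x then isNormalized u else isOne x

  PG : ℕ → Set
  PG k = Σ (Word k) (λ u → T (isNormalized u))

  -- A_G = G_{q,k}^T G : the row indexed by the point u is u^T G.
  A : ∀ {k n} → Matrix k n → PG k → Fin n → F
  A G (u , _) j = lookup (vecMat u G) j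

  𝒩A : ∀ {k n} → Matrix k n → PG k → Fin n → Bool
  𝒩A G u j = not (isZero (A G u j))

  record FieldAut : Set where
    field
      σ      : F → F
      bij    : ∀ b → ∃ λ a → σ a ≡ b
      inj    : ∀ a b → σ a ≡ σ b → a ≡ b
      pres-⊕ : ∀ a b → σ (a ⊕ b) ≡ σ a ⊕ σ b
      pres-⊗ : ∀ a b → σ (a ⊗ b) ≡ σ a ⊗ σ b
      pres-𝟙 : σ 𝟙 ≡ 𝟙

  data Elementary (n : ℕ) : (Word n → Word n) → Set where
    permute : (π : Fin n ↔ Fin n) →
              Elementary n (λ w → tabulate (λ i → lookup w (Inverse.to π i)))
    scale   : (i : Fin n) (a : F) → a ≢ 𝟘 →
              Elementary n (λ w → updateAt w i (a ⊗_))
    fieldAut : (φ : FieldAut) →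
              Elementary n (map (FieldAut.σ φ))

  Step : ∀ {n} → (Word n → Set) → (Word n → Set) → Set
  Step {n} C D = Σ (Word n → Word n) λ f → Elementary n f ×
                   (∀ w → D w ⇔ (∃ λ v → C v × f v ≡ w))

  Equivalent : ∀ {n} → (Word n → Set) → (Word n → Set) → Set₁
  Equivalent C D = Star Step C D

BinIso : ∀ {R : Set} {n : ℕ} → (R → Fin n → Bool) → (R → Fin n → Bool) → Set
BinIso {R} {n} M₁ M₂ =
  Σ (R ↔ R) λ ρ → Σ (Fin n ↔ Fin n) λ τ →
    ∀ r j → M₂ r j ≡ M₁ (Inverse.to ρ r) (Inverse.to τ j)

-- The prime field F q has no nontrivial automorphisms, so every elementary
-- transformation, and hence every equivalence of codes, is a monomial map
-- h w = (a j * w (τ j)) j with all a j ≢ 0. If h carries the code of G₁ onto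
-- the code of G₂, then u ↦ h (u G₁) and u ↦ u G₂ are injective homogeneous maps
-- with the same image, so matching each projective point r with the point ρ r
-- for which r G₂ is a nonzero multiple of h ((ρ r) G₁) is a bijection of
-- PG(k-1,q). A nonzero multiple of h w vanishes at j exactly when w vanishes at
-- τ j, hence ρ and τ give an isomorphism between 𝒩(A_G₁) and 𝒩(A_G₂).

module Submission where

open import Defs
open import Algebra.Bundles using (CommutativeRing)
open import Algebra.Structures using (IsCommutativeRing)
open import Algebra.Consequences.Propositional using (comm∧idˡ⇒id; comm∧invˡ⇒inv; comm∧distrˡ⇒distrʳ)
open import Data.Bool using (true; false; T; if_then_else_; not)
open import Data.Bool.Properties using (T-≡; ⇔→≡; T-irrelevant)
open import Data.Empty using (⊥-elim)
open import Data.Fin using (Fin; toℕ)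
import Data.Fin as Fin
open import Data.Fin.Properties using (toℕ-injective; toℕ-fromℕ<; toℕ<n)
open import Data.Nat as ℕ using (ℕ; NonZero; zero; suc; _%_; _∸_; _≥_)
import Data.Nat.Properties as ℕ
open import Data.Nat.Coprimality using (coprime-Bézout; prime⇒coprime)
open import Data.Nat.DivMod using (_mod_; %-distribˡ-+; %-distribˡ-*; m<n⇒m%n≡m; n%n≡0; m*n%n≡0; [m+kn]%n≡m%n)
open import Data.Nat.GCD using (module Bézout)
open import Data.Nat.Primality using (Prime; prime⇒nonTrivial)
open import Data.Product using (Σ; _,_; ∃; _×_; proj₁; proj₂)
open import Data.Sum using (_⊎_; inj₁; inj₂)
open import Data.Vec using (Vec; []; _∷_; lookup; tabulate; updateAt)
open import Data.Vec.Properties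
  using (∷-injectiveˡ; ∷-injectiveʳ; lookup∘tabulate; tabulate∘lookup; tabulate-cong; lookup-map;
         lookup∘updateAt; lookup∘updateAt′; map-cong; map-id)
open import Function using (case_of_; _∘_)
open import Function.Bundles using (_⇔_; mk⇔; Equivalence; _↔_; Inverse; mk↔ₛ′)
open import Function.Construct.Composition using (_↔-∘_)
open import Function.Construct.Identity using (↔-id)
open import Function.Definitions using (Injective)
open import Level using (0ℓ)
open import Relation.Nullary using (¬_; yes; no)
open import Relation.Binary.PropositionalEquality
import Relation.Binary.Construct.Closure.ReflexiveTransitive as Star

lookup-ext : ∀ {A : Set} {n} {u v : Vec A n} → (∀ i → lookup u i ≡ lookup v i) → u ≡ v
lookup-ext {u = u} {v} eq = trans (sym (tabulate∘lookup u)) (trans (tabulate-cong eq) (tabulate∘lookup v))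

module ModularArithmetic (q : ℕ) .{{_ : NonZero q}} where

  infixl 6 _+_
  infixl 7 _*_

  _+_ : F q → F q → F q
  _+_ = _⊕_ q

  _*_ : F q → F q → F q
  _*_ = _⊗_ q

  -_ : F q → F q
  - a = (q ∸ toℕ a) mod q

  ι : ℕ → F q
  ι m = m mod q

  toℕ-ι : ∀ m → toℕ (ι m) ≡ m % q
  toℕ-ι m = toℕ-fromℕ< _

  ι-≡ : ∀ {m n} → m % q ≡ n % q → ι m ≡ ι n
  ι-≡ {m} {n} eq = toℕ-injective (trans (toℕ-ι m) (trans eq (sym (toℕ-ι n))))

  ι-toℕ : ∀ a → ι (toℕ a) ≡ a
  ι-toℕ a = toℕ-injective (trans (toℕ-ι (toℕ a)) (m<n⇒m%n≡m (toℕ<n a)))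

  ι-q : ι q ≡ 𝟘 q
  ι-q = ι-≡ (trans (n%n≡0 q) (sym (m*n%n≡0 0 q)))

  ι-multiple : ∀ x → ι (x ℕ.* q) ≡ 𝟘 q
  ι-multiple x = ι-≡ (trans (m*n%n≡0 x q) (sym (m*n%n≡0 0 q)))

  ι-+ : ∀ m n → ι (m ℕ.+ n) ≡ ι m + ι n
  ι-+ m n = ι-≡ (trans (%-distribˡ-+ m n q) (sym (cong₂ (λ x y → (x ℕ.+ y) % q) (toℕ-ι m) (toℕ-ι n))))

  ι-* : ∀ m n → ι (m ℕ.* n) ≡ ι m * ι n
  ι-* m n = ι-≡ (trans (%-distribˡ-* m n q) (sym (cong₂ (λ x y → (x ℕ.* y) % q) (toℕ-ι m) (toℕ-ι n))))

  ι-+ˡ : ∀ m b → ι m + b ≡ ι (m ℕ.+ toℕ b)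
  ι-+ˡ m b = sym (trans (ι-+ m (toℕ b)) (cong (ι m +_) (ι-toℕ b)))

  ι-+ʳ : ∀ a n → a + ι n ≡ ι (toℕ a ℕ.+ n)
  ι-+ʳ a n = sym (trans (ι-+ (toℕ a) n) (cong (_+ ι n) (ι-toℕ a)))

  ι-*ˡ : ∀ m b → ι m * b ≡ ι (m ℕ.* toℕ b)
  ι-*ˡ m b = sym (trans (ι-* m (toℕ b)) (cong (ι m *_) (ι-toℕ b)))

  ι-*ʳ : ∀ a n → a * ι n ≡ ι (toℕ a ℕ.* n)
  ι-*ʳ a n = sym (trans (ι-* (toℕ a) n) (cong (_* ι n) (ι-toℕ a)))

  open ≡-Reasoning

  -- a + b and a * b are by definition ι (toℕ a + toℕ b) and ι (toℕ a * toℕ b),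
  -- so each law is the corresponding law of ℕ transported along ι.
  private
    +-comm : ∀ a b → a + b ≡ b + a
    +-comm a b = cong ι (ℕ.+-comm (toℕ a) (toℕ b))

    *-comm : ∀ a b → a * b ≡ b * a
    *-comm a b = cong ι (ℕ.*-comm (toℕ a) (toℕ b))

    +-assoc : ∀ a b c → (a + b) + c ≡ a + (b + c)
    +-assoc a b c = begin
      ι (toℕ a ℕ.+ toℕ b) + c         ≡⟨ ι-+ˡ _ c ⟩
      ι (toℕ a ℕ.+ toℕ b ℕ.+ toℕ c)   ≡⟨ cong ι (ℕ.+-assoc (toℕ a) _ _) ⟩
      ι (toℕ a ℕ.+ (toℕ b ℕ.+ toℕ c)) ≡⟨ ι-+ʳ a _ ⟨
      a + (b + c)                     ∎

    *-assoc : ∀ a b c → (a * b) * c ≡ a * (b * c)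
    *-assoc a b c = begin
      ι (toℕ a ℕ.* toℕ b) * c         ≡⟨ ι-*ˡ _ c ⟩
      ι (toℕ a ℕ.* toℕ b ℕ.* toℕ c)   ≡⟨ cong ι (ℕ.*-assoc (toℕ a) _ _) ⟩
      ι (toℕ a ℕ.* (toℕ b ℕ.* toℕ c)) ≡⟨ ι-*ʳ a _ ⟨
      a * (b * c)                     ∎

    distribˡ : ∀ a b c → a * (b + c) ≡ a * b + a * c
    distribˡ a b c = begin
      a * ι (toℕ b ℕ.+ toℕ c)                 ≡⟨ ι-*ʳ a _ ⟩
      ι (toℕ a ℕ.* (toℕ b ℕ.+ toℕ c))         ≡⟨ cong ι (ℕ.*-distribˡ-+ (toℕ a) _ _) ⟩
      ι (toℕ a ℕ.* toℕ b ℕ.+ toℕ a ℕ.* toℕ c) ≡⟨ ι-+ _ _ ⟩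
      a * b + a * c                           ∎

    +-identityˡ : ∀ a → 𝟘 q + a ≡ a
    +-identityˡ a = trans (ι-+ˡ 0 a) (ι-toℕ a)

    *-identityˡ : ∀ a → 𝟙 q * a ≡ a
    *-identityˡ a = trans (ι-*ˡ 1 a) (trans (cong ι (ℕ.*-identityˡ (toℕ a))) (ι-toℕ a))

    -‿inverseˡ : ∀ a → - a + a ≡ 𝟘 q
    -‿inverseˡ a = begin
      - a + a                   ≡⟨ +-comm (- a) a ⟩
      a + ι (q ∸ toℕ a)         ≡⟨ ι-+ʳ a _ ⟩
      ι (toℕ a ℕ.+ (q ∸ toℕ a)) ≡⟨ cong ι (ℕ.m+[n∸m]≡n (ℕ.<⇒≤ (toℕ<n a))) ⟩
      ι q                       ≡⟨ ι-q ⟩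
      𝟘 q                       ∎

  isCommutativeRing : IsCommutativeRing _≡_ _+_ _*_ -_ (𝟘 q) (𝟙 q)
  isCommutativeRing = record
    { isRing = record
      { +-isAbelianGroup = record
        { isGroup = record
          { isMonoid = record
            { isSemigroup = record
              { isMagma = record { isEquivalence = isEquivalence ; ∙-cong = cong₂ _+_ }
              ; assoc = +-assoc }
            ; identity = comm∧idˡ⇒id +-comm +-identityˡ }
          ; inverse = comm∧invˡ⇒inv +-comm -‿inverseˡ
          ; ⁻¹-cong = cong -_ }
        ; comm = +-comm }
      ; *-cong = cong₂ _*_
      ; *-assoc = *-assoc
      ; *-identity = comm∧idˡ⇒id *-comm *-identityˡ
      ; distrib = distribˡ , comm∧distrˡ⇒distrʳ *-comm distribˡ }
    ; *-comm = *-comm }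

  commutativeRing : CommutativeRing 0ℓ 0ℓ
  commutativeRing = record { isCommutativeRing = isCommutativeRing }

  toℕ-𝟘 : toℕ (𝟘 q) ≡ 0
  toℕ-𝟘 = trans (toℕ-ι 0) (m*n%n≡0 0 q)

  isZero≡true⇔≡𝟘 : ∀ {a} → isZero q a ≡ true ⇔ a ≡ 𝟘 q
  isZero≡true⇔≡𝟘 {a} = mk⇔
    (λ z → toℕ-injective (trans (ℕ.≡ᵇ⇒≡ (toℕ a) 0 (Equivalence.from T-≡ z)) (sym toℕ-𝟘)))
    (λ { refl → Equivalence.to T-≡ (ℕ.≡⇒≡ᵇ (toℕ (𝟘 q)) 0 toℕ-𝟘) })

  FieldAut-trivial : (φ : FieldAut q) → ∀ a → FieldAut.σ φ a ≡ a
  FieldAut-trivial φ a = trans (cong σ (sym (ι-toℕ a))) (trans (σ-ι (toℕ a)) (ι-toℕ a))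
    where
      open FieldAut φ
      open import Algebra.Properties.Group (CommutativeRing.+-group commutativeRing) using (identityˡ-unique)

      σ-𝟘 : σ (𝟘 q) ≡ 𝟘 q
      σ-𝟘 = identityˡ-unique (σ (𝟘 q)) (σ (𝟘 q))
        (trans (sym (pres-⊕ (𝟘 q) (𝟘 q))) (cong σ (CommutativeRing.+-identityˡ commutativeRing (𝟘 q))))

      σ-ι : ∀ m → σ (ι m) ≡ ι m
      σ-ι zero    = σ-𝟘
      σ-ι (suc m) = begin
        σ (ι (1 ℕ.+ m))   ≡⟨ cong σ (ι-+ 1 m) ⟩
        σ (𝟙 q + ι m)     ≡⟨ pres-⊕ (𝟙 q) (ι m) ⟩
        σ (𝟙 q) + σ (ι m) ≡⟨ cong₂ _+_ pres-𝟙 (σ-ι m) ⟩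
        𝟙 q + ι m         ≡⟨ ι-+ 1 m ⟨
        ι (1 ℕ.+ m)       ∎

module PrimeField (q : ℕ) .{{_ : NonZero q}} (q-prime : Prime q) where

  open ModularArithmetic q
    using (ι; ι-toℕ; ι-+; ι-*ˡ; ι-≡; ι-multiple; toℕ-ι; toℕ-𝟘; commutativeRing; isZero≡true⇔≡𝟘)
  open CommutativeRing commutativeRing using (_+_; _*_; -_; 0#; 1#; *-identityˡ; *-assoc; zeroʳ; ring)
  open import Algebra.Properties.Ring ring using (-‿distribˡ-*; -‿involutive; +-inverseʳ-unique)
  open ≡-Reasoning

  1<q : 1 ℕ.< q
  1<q = ℕ.nonTrivial⇒n>1 q {{prime⇒nonTrivial q-prime}}

  toℕ-𝟙 : toℕ 1# ≡ 1
  toℕ-𝟙 = trans (toℕ-ι 1) (m<n⇒m%n≡m 1<q)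

  1#≢0# : 1# ≢ 0#
  1#≢0# eq with trans (sym toℕ-𝟙) (trans (cong toℕ eq) (toℕ-𝟘))
  ... | ()

  isOne≡true⇔≡𝟙 : ∀ {a} → isOne q a ≡ true ⇔ a ≡ 1#
  isOne≡true⇔≡𝟙 {a} = mk⇔
    (λ o → toℕ-injective (trans (ℕ.≡ᵇ⇒≡ (toℕ a) 1 (Equivalence.from T-≡ o)) (sym toℕ-𝟙)))
    (λ { refl → Equivalence.to T-≡ (ℕ.≡⇒≡ᵇ (toℕ 1#) 1 toℕ-𝟙) })

  -- q and a are coprime, so Bézout gives 1 + y a ≡ x q or 1 + x q ≡ y a.
  *-inverseˡ : ∀ a → a ≢ 0# → ∃ λ b → b * a ≡ 1#
  *-inverseˡ a a≢0 = fromBézout (coprime-Bézout (prime⇒coprime q-prime {{a-nonZero}} (toℕ<n a)))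
    where
      a-nonZero : NonZero (toℕ a)
      a-nonZero = ℕ.≢-nonZero λ a≡0 → a≢0 (toℕ-injective (trans a≡0 (sym (toℕ-𝟘))))

      fromBézout : Bézout.Identity 1 q (toℕ a) → ∃ λ b → b * a ≡ 1#
      fromBézout (Bézout.+- x y eq) = - ι y , (begin
        - ι y * a   ≡⟨ -‿distribˡ-* (ι y) a ⟨
        - (ι y * a) ≡⟨ cong -_ (+-inverseʳ-unique 1# (ι y * a) 1+ya≡0) ⟩
        - (- 1#)    ≡⟨ -‿involutive 1# ⟩
        1#          ∎)
        where
          1+ya≡0 : 1# + ι y * a ≡ 0#
          1+ya≡0 = begin
            1# + ι y * a          ≡⟨ cong (1# +_) (ι-*ˡ y a) ⟩
            1# + ι (y ℕ.* toℕ a)  ≡⟨ ι-+ 1 _ ⟨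
            ι (1 ℕ.+ y ℕ.* toℕ a) ≡⟨ cong ι eq ⟩
            ι (x ℕ.* q)           ≡⟨ ι-multiple x ⟩
            0#                    ∎
      fromBézout (Bézout.-+ x y eq) = ι y , (begin
        ι y * a               ≡⟨ ι-*ˡ y a ⟩
        ι (y ℕ.* toℕ a)       ≡⟨ cong ι eq ⟨
        ι (1 ℕ.+ x ℕ.* q)     ≡⟨ ι-≡ ([m+kn]%n≡m%n 1 x q) ⟩
        1#                    ∎)

  *-cancelˡ : ∀ a {x y} → a ≢ 0# → a * x ≡ a * y → x ≡ y
  *-cancelˡ a {x} {y} a≢0 eq with *-inverseˡ a a≢0
  ... | b , ba≡1 = begin
    x           ≡⟨ *-identityˡ x ⟨
    1# * x      ≡⟨ cong (_* x) ba≡1 ⟨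
    (b * a) * x ≡⟨ *-assoc b a x ⟩
    b * (a * x) ≡⟨ cong (b *_) eq ⟩
    b * (a * y) ≡⟨ *-assoc b a y ⟨
    (b * a) * y ≡⟨ cong (_* y) ba≡1 ⟩
    1# * y      ≡⟨ *-identityˡ y ⟩
    y           ∎

  *-≢0 : ∀ {a b} → a ≢ 0# → b ≢ 0# → a * b ≢ 0#
  *-≢0 {a} a≢0 b≢0 ab≡0 = b≢0 (*-cancelˡ a a≢0 (trans ab≡0 (sym (zeroʳ a))))

  isZero-* : ∀ {a} b → a ≢ 0# → isZero q (a * b) ≡ isZero q b
  isZero-* {a} b a≢0 = ⇔→≡ (mk⇔
    (λ z → Equivalence.from isZero≡true⇔≡𝟘 (*-cancelˡ a a≢0 (trans (Equivalence.to isZero≡true⇔≡𝟘 z) (sym (zeroʳ a)))))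
    (λ z → Equivalence.from isZero≡true⇔≡𝟘 (trans (cong (a *_) (Equivalence.to isZero≡true⇔≡𝟘 z)) (zeroʳ a))))

module Words (q : ℕ) .{{_ : NonZero q}} where

  open ModularArithmetic q using (commutativeRing)
  open CommutativeRing commutativeRing
    using (_+_; _*_; -_; 0#; 1#; +-identityˡ; -‿inverseʳ; *-assoc; *-identityˡ; zeroˡ; zeroʳ;
           distribˡ; distribʳ; ring; +-commutativeSemigroup)
  open import Algebra.Properties.Ring ring using (-1*x≈-x; x∙y⁻¹≈ε⇒x≈y)
  open import Algebra.Properties.CommutativeSemigroup +-commutativeSemigroup using (interchange)
  open ≡-Reasoning

  infixl 6 _+ʷ_ _-ʷ_
  infixr 7 _·_

  0ʷ : ∀ {n} → Word q n
  0ʷ = zeroW q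

  _+ʷ_ : ∀ {n} → Word q n → Word q n → Word q n
  _+ʷ_ = _+W_ q

  _·_ : ∀ {n} → F q → Word q n → Word q n
  _·_ = scaleW q

  _-ʷ_ : ∀ {n} → Word q n → Word q n → Word q n
  u -ʷ v = u +ʷ (- 1#) · v

  Homogeneous : ∀ {k n} → (Word q k → Word q n) → Set
  Homogeneous f = ∀ c u → f (c · u) ≡ c · f u

  +ʷ-interchange : ∀ {n} (u v w x : Word q n) → (u +ʷ v) +ʷ (w +ʷ x) ≡ (u +ʷ w) +ʷ (v +ʷ x)
  +ʷ-interchange []       []       []       []       = refl
  +ʷ-interchange (a ∷ u) (b ∷ v) (c ∷ w) (d ∷ x) = cong₂ _∷_ (interchange a b c d) (+ʷ-interchange u v w x)

  ·-distribˡ : ∀ {n} c (u v : Word q n) → c · (u +ʷ v) ≡ c · u +ʷ c · v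
  ·-distribˡ c []      []      = refl
  ·-distribˡ c (a ∷ u) (b ∷ v) = cong₂ _∷_ (distribˡ c a b) (·-distribˡ c u v)

  ·-distribʳ : ∀ {n} c d (u : Word q n) → (c + d) · u ≡ c · u +ʷ d · u
  ·-distribʳ c d []      = refl
  ·-distribʳ c d (a ∷ u) = cong₂ _∷_ (distribʳ a c d) (·-distribʳ c d u)

  ·-assoc : ∀ {n} c d (u : Word q n) → (c * d) · u ≡ c · d · u
  ·-assoc c d []      = refl
  ·-assoc c d (a ∷ u) = cong₂ _∷_ (*-assoc c d a) (·-assoc c d u)

  ·-identityˡ : ∀ {n} (u : Word q n) → 1# · u ≡ u
  ·-identityˡ []      = refl
  ·-identityˡ (a ∷ u) = cong₂ _∷_ (*-identityˡ a) (·-identityˡ u)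

  ·-zeroˡ : ∀ {n} (u : Word q n) → 0# · u ≡ 0ʷ
  ·-zeroˡ []      = refl
  ·-zeroˡ (a ∷ u) = cong₂ _∷_ (zeroˡ a) (·-zeroˡ u)

  ·-zeroʳ : ∀ {n} c → c · 0ʷ {n} ≡ 0ʷ
  ·-zeroʳ {zero}  c = refl
  ·-zeroʳ {suc n} c = cong₂ _∷_ (zeroʳ c) (·-zeroʳ c)

  +ʷ-identityˡ : ∀ {n} (u : Word q n) → 0ʷ +ʷ u ≡ u
  +ʷ-identityˡ []      = refl
  +ʷ-identityˡ (a ∷ u) = cong₂ _∷_ (+-identityˡ a) (+ʷ-identityˡ u)

  -ʷ-self : ∀ {n} (u : Word q n) → u -ʷ u ≡ 0ʷ
  -ʷ-self []      = refl
  -ʷ-self (a ∷ u) = cong₂ _∷_ (trans (cong (a +_) (-1*x≈-x a)) (-‿inverseʳ a)) (-ʷ-self u)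

  -ʷ≡0ʷ⇒≡ : ∀ {n} (u v : Word q n) → u -ʷ v ≡ 0ʷ → u ≡ v
  -ʷ≡0ʷ⇒≡ []      []      _  = refl
  -ʷ≡0ʷ⇒≡ (a ∷ u) (b ∷ v) eq = cong₂ _∷_
    (x∙y⁻¹≈ε⇒x≈y a b (trans (cong (a +_) (sym (-1*x≈-x b))) (∷-injectiveˡ eq)))
    (-ʷ≡0ʷ⇒≡ u v (∷-injectiveʳ eq))

  vecMat-+ʷ : ∀ {k n} (u v : Word q k) (G : Matrix q k n) →
              vecMat q (u +ʷ v) G ≡ vecMat q u G +ʷ vecMat q v G
  vecMat-+ʷ []      []      []      = sym (+ʷ-identityˡ 0ʷ)
  vecMat-+ʷ (c ∷ u) (d ∷ v) (r ∷ G) = begin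
    (c + d) · r +ʷ vecMat q (u +ʷ v) G                   ≡⟨ cong₂ _+ʷ_ (·-distribʳ c d r) (vecMat-+ʷ u v G) ⟩
    (c · r +ʷ d · r) +ʷ (vecMat q u G +ʷ vecMat q v G) ≡⟨ +ʷ-interchange (c · r) (d · r) _ _ ⟩
    (c · r +ʷ vecMat q u G) +ʷ (d · r +ʷ vecMat q v G) ∎

  vecMat-homogeneous : ∀ {k n} (G : Matrix q k n) → Homogeneous (λ u → vecMat q u G)
  vecMat-homogeneous []      c []      = sym (·-zeroʳ c)
  vecMat-homogeneous (r ∷ G) c (a ∷ u) = begin
    (c * a) · r +ʷ vecMat q (c · u) G   ≡⟨ cong₂ _+ʷ_ (·-assoc c a r) (vecMat-homogeneous G c u) ⟩
    c · a · r +ʷ c · vecMat q u G       ≡⟨ ·-distribˡ c (a · r) (vecMat q u G) ⟨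
    c · (a · r +ʷ vecMat q u G)         ∎

  vecMat-injective : ∀ {k n} (G : Matrix q k n) → FullRank q G → Injective _≡_ _≡_ (λ u → vecMat q u G)
  vecMat-injective G full-rank {u} {v} uG≡vG = -ʷ≡0ʷ⇒≡ u v (full-rank (u -ʷ v) (begin
    vecMat q (u -ʷ v) G                       ≡⟨ vecMat-+ʷ u ((- 1#) · v) G ⟩
    vecMat q u G +ʷ vecMat q ((- 1#) · v) G   ≡⟨ cong₂ _+ʷ_ uG≡vG (vecMat-homogeneous G (- 1#) v) ⟩
    vecMat q v G -ʷ vecMat q v G              ≡⟨ -ʷ-self (vecMat q v G) ⟩
    0ʷ                                        ∎))

module ProjectivePoints (q : ℕ) .{{_ : NonZero q}} (q-prime : Prime q) where

  open ModularArithmetic q using (commutativeRing; isZero≡true⇔≡𝟘)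
  open CommutativeRing commutativeRing using (_*_; 0#; 1#; *-comm; *-identityʳ; zeroʳ)
  open PrimeField q q-prime using (1#≢0#; isOne≡true⇔≡𝟙; *-inverseˡ)
  open Words q
  open ≡-Reasoning

  Normalized : ∀ {k} → Word q k → Set
  Normalized u = T (isNormalized q u)

  isZero-0# : isZero q 0# ≡ true
  isZero-0# = Equivalence.from isZero≡true⇔≡𝟘 refl

  isZero-1# : isZero q 1# ≡ false
  isZero-1# with isZero q 1# in eq
  ... | true  = ⊥-elim (1#≢0# (Equivalence.to isZero≡true⇔≡𝟘 eq))
  ... | false = refl

  normalized-0#∷ : ∀ {k} {u : Word q k} → Normalized u → Normalized (0# ∷ u)
  normalized-0#∷ {u = u} n = subst T (cong (λ z → if z then isNormalized q u else isOne q 0#) (sym isZero-0#)) n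

  normalized-1#∷ : ∀ {k} (u : Word q k) → Normalized (1# ∷ u)
  normalized-1#∷ u = Equivalence.from T-≡
    (trans (cong (λ z → if z then isNormalized q u else isOne q 1#) isZero-1#) (Equivalence.from isOne≡true⇔≡𝟙 refl))

  normalized-head : ∀ {k} x (u : Word q k) → Normalized (x ∷ u) → (x ≡ 0# × Normalized u) ⊎ x ≡ 1#
  normalized-head x u n with isZero q x in eq
  ... | true  = inj₁ (Equivalence.to isZero≡true⇔≡𝟘 eq , n)
  ... | false = inj₂ (Equivalence.to isOne≡true⇔≡𝟙 (Equivalence.to T-≡ n))

  0ʷ-not-normalized : ∀ k → ¬ Normalized (0ʷ {k})
  0ʷ-not-normalized zero    ()
  0ʷ-not-normalized (suc k) n with normalized-head 0# (0ʷ {k}) n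
  ... | inj₁ (_ , n′) = 0ʷ-not-normalized k n′
  ... | inj₂ 0≡1      = 1#≢0# (sym 0≡1)

  normalized⇒≢0ʷ : ∀ {k} {u : Word q k} → Normalized u → u ≢ 0ʷ
  normalized⇒≢0ʷ {k} n refl = 0ʷ-not-normalized k n

  point-≡ : ∀ {k} {p p′ : PG q k} → proj₁ p ≡ proj₁ p′ → p ≡ p′
  point-≡ {p = u , n} {.u , n′} refl = cong (u ,_) (T-irrelevant n n′)

  normalize : ∀ {k} (u : Word q k) → u ≢ 0ʷ → Σ (PG q k) λ p → ∃ λ c → c ≢ 0# × u ≡ c · proj₁ p
  normalize []      []≢0ʷ = ⊥-elim ([]≢0ʷ refl)
  normalize (x ∷ u) x∷u≢0ʷ with isZero q x in eq
  ... | true =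
    let x≡0 = Equivalence.to isZero≡true⇔≡𝟘 eq
        (p , n) , c , c≢0 , u≡cp = normalize u (λ u≡0ʷ → x∷u≢0ʷ (cong₂ _∷_ x≡0 u≡0ʷ))
    in (0# ∷ p , normalized-0#∷ {u = p} n) , c , c≢0 , cong₂ _∷_ (trans x≡0 (sym (zeroʳ c))) u≡cp
  ... | false =
    let x≢0 = λ x≡0 → case trans (sym eq) (Equivalence.from isZero≡true⇔≡𝟘 x≡0) of λ ()
        b , bx≡1 = *-inverseˡ x x≢0
    in (1# ∷ b · u , normalized-1#∷ (b · u)) , x , x≢0 , cong₂ _∷_ (sym (*-identityʳ x)) (begin
      u             ≡⟨ ·-identityˡ u ⟨
      1# · u        ≡⟨ cong (_· u) (trans (*-comm x b) bx≡1) ⟨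
      (x * b) · u   ≡⟨ ·-assoc x b u ⟩
      x · b · u     ∎)

  normalized-unique : ∀ {k} {u v : Word q k} (c : F q) → Normalized u → Normalized v → v ≡ c · u → u ≡ v
  normalized-unique {suc k} {x ∷ u} {y ∷ v} c nu nv v≡cu
    with normalized-head x u nu | normalized-head y v nv
       | ∷-injectiveˡ v≡cu | ∷-injectiveʳ v≡cu
  ... | inj₁ (refl , nu′) | inj₁ (refl , nv′) | _ | v≡cu′ = cong (0# ∷_) (normalized-unique c nu′ nv′ v≡cu′)
  ... | inj₁ (refl , _)   | inj₂ refl | 1≡c0 | _ = ⊥-elim (1#≢0# (trans 1≡c0 (zeroʳ c)))
  ... | inj₂ refl | inj₁ (refl , nv′) | 0≡c1 | v≡cu′ =
    ⊥-elim (0ʷ-not-normalized k (subst Normalized (trans v≡cu′ (trans (cong (_· u) c≡0) (·-zeroˡ u))) nv′))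
    where c≡0 = trans (sym (*-identityʳ c)) (sym 0≡c1)
  ... | inj₂ refl | inj₂ refl | 1≡c1 | v≡cu′ =
    cong (1# ∷_) (sym (trans v≡cu′ (trans (cong (_· u) c≡1) (·-identityˡ u))))
    where c≡1 = trans (sym (*-identityʳ c)) (sym 1≡c1)

module MonomialMaps (q : ℕ) .{{_ : NonZero q}} (q-prime : Prime q) where

  open ModularArithmetic q using (commutativeRing; FieldAut-trivial)
  open CommutativeRing commutativeRing using (_*_; 0#; 1#; *-assoc; *-identityˡ; *-commutativeSemigroup)
  open import Algebra.Properties.CommutativeSemigroup *-commutativeSemigroup using (x∙yz≈y∙xz)
  open PrimeField q q-prime using (1#≢0#; *-≢0; *-cancelˡ)
  open Words q
  open ≡-Reasoning

  record Monomial (n : ℕ) : Set where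
    field
      perm    : Fin n ↔ Fin n
      coeff   : Fin n → F q
      coeff≢0 : ∀ j → coeff j ≢ 0#

    apply : Word q n → Word q n
    apply v = tabulate λ j → coeff j * lookup v (Inverse.to perm j)

    lookup-apply : ∀ v j → lookup (apply v) j ≡ coeff j * lookup v (Inverse.to perm j)
    lookup-apply v j = lookup∘tabulate _ j

    apply-homogeneous : Homogeneous apply
    apply-homogeneous c v = lookup-ext λ j → begin
      lookup (apply (c · v)) j                          ≡⟨ lookup-apply (c · v) j ⟩
      coeff j * lookup (c · v) (Inverse.to perm j)      ≡⟨ cong (coeff j *_) (lookup-map _ (c *_) v) ⟩
      coeff j * (c * lookup v (Inverse.to perm j))      ≡⟨ x∙yz≈y∙xz (coeff j) c _ ⟩
      c * (coeff j * lookup v (Inverse.to perm j))      ≡⟨ cong (c *_) (lookup-apply v j) ⟨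
      c * lookup (apply v) j                            ≡⟨ lookup-map j (c *_) (apply v) ⟨
      lookup (c · apply v) j                            ∎

    apply-injective : Injective _≡_ _≡_ apply
    apply-injective {v} {v′} eq = lookup-ext λ i → begin
      lookup v i                                        ≡⟨ cong (lookup v) (Inverse.strictlyInverseˡ perm i) ⟨
      lookup v (Inverse.to perm (Inverse.from perm i))  ≡⟨ permuted-eq (Inverse.from perm i) ⟩
      lookup v′ (Inverse.to perm (Inverse.from perm i)) ≡⟨ cong (lookup v′) (Inverse.strictlyInverseˡ perm i) ⟩
      lookup v′ i                                       ∎
      where
        permuted-eq : ∀ j → lookup v (Inverse.to perm j) ≡ lookup v′ (Inverse.to perm j)
        permuted-eq j = *-cancelˡ (coeff j) (coeff≢0 j)
          (trans (sym (lookup-apply v j)) (trans (cong (λ w → lookup w j) eq) (lookup-apply v′ j)))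

  open Monomial public

  id-monomial : ∀ {n} → Monomial n
  id-monomial {n} = record { perm = ↔-id (Fin n) ; coeff = λ _ → 1# ; coeff≢0 = λ _ → 1#≢0# }

  apply-id : ∀ {n} (v : Word q n) → apply id-monomial v ≡ v
  apply-id v = lookup-ext λ j → trans (lookup-apply id-monomial v j) (*-identityˡ (lookup v j))

  infixr 9 _∘ᵐ_

  _∘ᵐ_ : ∀ {n} → Monomial n → Monomial n → Monomial n
  m ∘ᵐ m′ = record
    { perm    = perm m′ ↔-∘ perm m
    ; coeff   = λ j → coeff m j * coeff m′ (Inverse.to (perm m) j)
    ; coeff≢0 = λ j → *-≢0 (coeff≢0 m j) (coeff≢0 m′ (Inverse.to (perm m) j))
    }

  apply-∘ᵐ : ∀ {n} (m m′ : Monomial n) v → apply (m ∘ᵐ m′) v ≡ apply m (apply m′ v)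
  apply-∘ᵐ m m′ v = lookup-ext λ j → let τj = Inverse.to (perm m) j in begin
    lookup (apply (m ∘ᵐ m′) v) j                                    ≡⟨ lookup-apply (m ∘ᵐ m′) v j ⟩
    coeff m j * coeff m′ τj * lookup v (Inverse.to (perm m′) τj)   ≡⟨ *-assoc (coeff m j) _ _ ⟩
    coeff m j * (coeff m′ τj * lookup v (Inverse.to (perm m′) τj)) ≡⟨ cong (coeff m j *_) (lookup-apply m′ v τj) ⟨
    coeff m j * lookup (apply m′ v) τj                              ≡⟨ lookup-apply m (apply m′ v) j ⟨
    lookup (apply m (apply m′ v)) j                                 ∎

  coordinateScaling : ∀ {n} (i : Fin n) (a : F q) → a ≢ 0# → Monomial n
  coordinateScaling {n} i a a≢0 = record { perm = ↔-id (Fin n) ; coeff = coeffAt ; coeff≢0 = coeffAt≢0 }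
    where
      coeffAt : Fin n → F q
      coeffAt j with i Fin.≟ j
      ... | yes _ = a
      ... | no  _ = 1#

      coeffAt≢0 : ∀ j → coeffAt j ≢ 0#
      coeffAt≢0 j with i Fin.≟ j
      ... | yes _ = a≢0
      ... | no  _ = 1#≢0#

  apply-coordinateScaling : ∀ {n} (i : Fin n) (a : F q) (a≢0 : a ≢ 0#) w →
                            updateAt w i (a *_) ≡ apply (coordinateScaling i a a≢0) w
  apply-coordinateScaling i a a≢0 w = lookup-ext λ j →
    trans (lookup-updateAt j) (sym (lookup-apply (coordinateScaling i a a≢0) w j))
    where
      lookup-updateAt : ∀ j → lookup (updateAt w i (a *_)) j ≡ coeff (coordinateScaling i a a≢0) j * lookup w j
      lookup-updateAt j with i Fin.≟ j
      ... | yes refl = lookup∘updateAt i w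
      ... | no  i≢j  = trans (lookup∘updateAt′ j i (i≢j ∘ sym) w) (sym (*-identityˡ (lookup w j)))

  elementary⇒monomial : ∀ {n} {f : Word q n → Word q n} → Elementary q n f → Σ (Monomial n) λ m → f ≗ apply m
  elementary⇒monomial (permute π) =
    record { perm = π ; coeff = λ _ → 1# ; coeff≢0 = λ _ → 1#≢0# } ,
    λ w → tabulate-cong λ j → sym (*-identityˡ (lookup w (Inverse.to π j)))
  elementary⇒monomial (scale i a a≢0) = coordinateScaling i a a≢0 , apply-coordinateScaling i a a≢0
  elementary⇒monomial (fieldAut φ) =
    id-monomial , λ w → trans (map-cong (FieldAut-trivial φ) w) (trans (map-id w) (sym (apply-id w)))

  MonomiallyEquivalent : ∀ {n} → (Word q n → Set) → (Word q n → Set) → Set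
  MonomiallyEquivalent {n} C D = Σ (Monomial n) λ m → ∀ w → D w ⇔ (∃ λ v → C v × apply m v ≡ w)

  monomiallyEquivalent-refl : ∀ {n} {C : Word q n → Set} → MonomiallyEquivalent C C
  monomiallyEquivalent-refl {C = C} = id-monomial , λ w → mk⇔
    (λ Cw → w , Cw , apply-id w)
    (λ { (v , Cv , eq) → subst C (trans (sym (apply-id v)) eq) Cv })

  monomiallyEquivalent-trans : ∀ {n} {C D E : Word q n → Set} →
    MonomiallyEquivalent C D → MonomiallyEquivalent D E → MonomiallyEquivalent C E
  monomiallyEquivalent-trans (m , C~D) (m′ , D~E) = m′ ∘ᵐ m , λ w → mk⇔
    (λ Ew → let (u , Du , m′u≡w) = Equivalence.to (D~E w) Ew
                (v , Cv , mv≡u)  = Equivalence.to (C~D u) Du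
            in v , Cv , trans (apply-∘ᵐ m′ m v) (trans (cong (apply m′) mv≡u) m′u≡w))
    (λ { (v , Cv , eq) → Equivalence.from (D~E w)
           (apply m v , Equivalence.from (C~D (apply m v)) (v , Cv , refl) , trans (sym (apply-∘ᵐ m′ m v)) eq) })

  step⇒monomiallyEquivalent : ∀ {n} {C D : Word q n → Set} → Step q C D → MonomiallyEquivalent C D
  step⇒monomiallyEquivalent (f , elementary , C~D) with elementary⇒monomial elementary
  ... | m , f≗m = m , λ w → mk⇔
    (λ Dw → let (v , Cv , fv≡w) = Equivalence.to (C~D w) Dw in v , Cv , trans (sym (f≗m v)) fv≡w)
    (λ { (v , Cv , mv≡w) → Equivalence.from (C~D w) (v , Cv , trans (f≗m v) mv≡w) })

  equivalent⇒monomiallyEquivalent : ∀ {n} {C D : Word q n → Set} → Equivalent q C D → MonomiallyEquivalent C D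
  equivalent⇒monomiallyEquivalent = Star.fold MonomiallyEquivalent
    (λ step → monomiallyEquivalent-trans (step⇒monomiallyEquivalent step)) monomiallyEquivalent-refl

module ProjectiveCorrespondence (q : ℕ) .{{_ : NonZero q}} (q-prime : Prime q) where

  open ModularArithmetic q using (commutativeRing)
  open CommutativeRing commutativeRing using (_*_; 0#; *-assoc)
  open PrimeField q q-prime using (isZero-*)
  open Words q
  open ProjectivePoints q q-prime
  open MonomialMaps q q-prime
  open ≡-Reasoning

  record HomogeneousEmbedding (k n : ℕ) : Set where
    field
      map         : Word q k → Word q n
      homogeneous : Homogeneous map
      injective   : Injective _≡_ _≡_ map

    map-0ʷ : map 0ʷ ≡ 0ʷ
    map-0ʷ = begin
      map 0ʷ          ≡⟨ cong map (·-zeroˡ 0ʷ) ⟨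
      map (0# · 0ʷ)   ≡⟨ homogeneous 0# 0ʷ ⟩
      0# · map 0ʷ     ≡⟨ ·-zeroˡ (map 0ʷ) ⟩
      0ʷ              ∎

    proportional⇒≡ : ∀ {p p′ : PG q k} c → map (proj₁ p) ≡ c · map (proj₁ p′) → p′ ≡ p
    proportional⇒≡ {p , np} {p′ , np′} c eq =
      point-≡ (normalized-unique c np′ np (injective (trans eq (sym (homogeneous c p′)))))

  open HomogeneousEmbedding

  ImageWithin : ∀ {k n} → HomogeneousEmbedding k n → HomogeneousEmbedding k n → Set
  ImageWithin g f = ∀ u → ∃ λ v → map f v ≡ map g u

  record Match {k n} (f g : HomogeneousEmbedding k n) (r : PG q k) : Set where
    field
      point        : PG q k
      scalar       : F q
      scalar≢0     : scalar ≢ 0#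
      proportional : map g (proj₁ r) ≡ scalar · map f (proj₁ point)

  open Match

  matchingPoint : ∀ {k n} (f g : HomogeneousEmbedding k n) → ImageWithin g f → (r : PG q k) → Match f g r
  matchingPoint f g g⊆f (r , nr) with g⊆f r
  ... | v , fv≡gr with normalize v v≢0ʷ
    where
      v≢0ʷ : v ≢ 0ʷ
      v≢0ʷ refl = normalized⇒≢0ʷ nr (injective g (trans (sym fv≡gr) (trans (map-0ʷ f) (sym (map-0ʷ g)))))
  ... | p , c , c≢0 , v≡cp = record { point = p ; scalar = c ; scalar≢0 = c≢0 ; proportional = begin
    map g r                ≡⟨ fv≡gr ⟨
    map f v                ≡⟨ cong (map f) v≡cp ⟩
    map f (c · proj₁ p)    ≡⟨ homogeneous f c (proj₁ p) ⟩
    c · map f (proj₁ p)    ∎ }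

  matchingPoint-roundTrip : ∀ {k n} (f g : HomogeneousEmbedding k n) {p}
                            (back : Match g f p) (forth : Match f g (point back)) → point forth ≡ p
  matchingPoint-roundTrip f g {p} back forth = proportional⇒≡ f (d * c) (begin
    map f (proj₁ p)                       ≡⟨ proportional back ⟩
    d · map g (proj₁ (point back))        ≡⟨ cong (d ·_) (proportional forth) ⟩
    d · c · map f (proj₁ (point forth))   ≡⟨ ·-assoc d c _ ⟨
    (d * c) · map f (proj₁ (point forth)) ∎)
    where
      d = scalar back
      c = scalar forth

  projectiveBijection : ∀ {k n} (f g : HomogeneousEmbedding k n) → ImageWithin g f → ImageWithin f g →
                        Σ (PG q k ↔ PG q k) λ ρ → ∀ r →
                          ∃ λ c → c ≢ 0# × map g (proj₁ r) ≡ c · map f (proj₁ (Inverse.to ρ r))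
  projectiveBijection f g g⊆f f⊆g =
    mk↔ₛ′ (point ∘ forth) (point ∘ back)
      (λ p → matchingPoint-roundTrip f g (back p) (forth _))
      (λ r → matchingPoint-roundTrip g f (forth r) (back _)) ,
    λ r → scalar (forth r) , scalar≢0 (forth r) , proportional (forth r)
    where
      forth = matchingPoint f g g⊆f
      back  = matchingPoint g f f⊆g

  codeEmbedding : ∀ {k n} (G : Matrix q k n) → FullRank q G → HomogeneousEmbedding k n
  codeEmbedding G full-rank = record
    { map         = λ u → vecMat q u G
    ; homogeneous = vecMat-homogeneous G
    ; injective   = vecMat-injective G full-rank
    }

  infixr 9 _∘ᵉ_

  _∘ᵉ_ : ∀ {k n} → Monomial n → HomogeneousEmbedding k n → HomogeneousEmbedding k n
  m ∘ᵉ f = record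
    { map         = apply m ∘ map f
    ; homogeneous = λ c u → trans (cong (apply m) (homogeneous f c u)) (apply-homogeneous m c (map f u))
    ; injective   = injective f ∘ apply-injective m
    }

  isZero-scaled-monomial : ∀ {n} (m : Monomial n) {c} → c ≢ 0# → ∀ w j →
                           isZero q (lookup (c · apply m w) j) ≡ isZero q (lookup w (Inverse.to (perm m) j))
  isZero-scaled-monomial m {c} c≢0 w j = begin
    isZero q (lookup (c · apply m w) j)                     ≡⟨ cong (isZero q) (lookup-map j (c *_) (apply m w)) ⟩
    isZero q (c * lookup (apply m w) j)                     ≡⟨ isZero-* _ c≢0 ⟩
    isZero q (lookup (apply m w) j)                         ≡⟨ cong (isZero q) (lookup-apply m w j) ⟩
    isZero q (coeff m j * lookup w (Inverse.to (perm m) j)) ≡⟨ isZero-* _ (coeff≢0 m j) ⟩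
    isZero q (lookup w (Inverse.to (perm m) j))             ∎

  monomiallyEquivalent⇒BinIso : ∀ {k n} (G₁ G₂ : Matrix q k n) → FullRank q G₁ → FullRank q G₂ →
                                 MonomiallyEquivalent (Code q G₁) (Code q G₂) → BinIso (𝒩A q G₁) (𝒩A q G₂)
  monomiallyEquivalent⇒BinIso G₁ G₂ full₁ full₂ (m , C₁~C₂) = ρ , perm m , sameSupport
    where
      f = m ∘ᵉ codeEmbedding G₁ full₁
      g = codeEmbedding G₂ full₂

      g⊆f : ImageWithin g f
      g⊆f u with Equivalence.to (C₁~C₂ (vecMat q u G₂)) (u , refl)
      ... | _ , (v , refl) , m[vG₁]≡uG₂ = v , m[vG₁]≡uG₂

      f⊆g : ImageWithin f g
      f⊆g v = Equivalence.from (C₁~C₂ (map f v)) (vecMat q v G₁ , (v , refl) , refl)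

      bijection = projectiveBijection f g g⊆f f⊆g
      ρ         = proj₁ bijection

      sameSupport : ∀ r j → 𝒩A q G₂ r j ≡ 𝒩A q G₁ (Inverse.to ρ r) (Inverse.to (perm m) j)
      sameSupport r j with proj₂ bijection r
      ... | c , c≢0 , rG₂≡c·f[ρr] = cong not (trans (cong (λ w → isZero q (lookup w j)) rG₂≡c·f[ρr])
                                                   (isZero-scaled-monomial m c≢0 (vecMat q (proj₁ (Inverse.to ρ r)) G₁) j))

mainTheorem2 : (q : ℕ) .{{_ : NonZero q}} → Prime q →
    (k n : ℕ) → k ≥ 1 → n ≥ 1 →
    (G₁ G₂ : Matrix q k n) → FullRank q G₁ → FullRank q G₂ →
    ¬ BinIso (𝒩A q G₁) (𝒩A q G₂) →
    ¬ Equivalent q (Code q G₁) (Code q G₂)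
mainTheorem2 q q-prime k n _ _ G₁ G₂ full₁ full₂ not-isomorphic equivalent =
  not-isomorphic (monomiallyEquivalent⇒BinIso G₁ G₂ full₁ full₂ (equivalent⇒monomiallyEquivalent equivalent))
  where
    open MonomialMaps q q-prime using (equivalent⇒monomiallyEquivalent)
    open ProjectiveCorrespondence q q-prime using (monomiallyEquivalent⇒BinIso)
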